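{- For every non-deterministic register transducer with reassignments $T$, one can construct a non-deterministic register transducer $T'$ (without reassignments) such that $[\![T]\!]=[\![T']\!]$.
   Context: Fix finite alphabets $\Sigma,\Gamma$, a countably infinite set $\mathcal{D}$ of data values and a distinguished $d_0\in\mathcal{D}$. A test over a finite register set $R$ is a Boolean combination of $\top,\bot,r^{=},r^{\neq}$ ($r\in R$); for $\tau:R\to\mathcal{D}$ and $d\in\mathcal{D}$, $\tau,d\models r^{=}$ iff $\tau(r)=d$, $\tau,d\models r^{\neq}$ iff $\tau(r)\neq d$. A non-deterministic register transducer (NRT) is $T=(Q,R,i_0,F,\Delta)$ with finite states $Q$, initial $i_0$, accepting $F\subseteq Q$, finite register set $R$, and finite $\Delta\subseteq Q\times\Sigma\times\mathrm{Tests}_R\times2^R\times(\Gamma\times R)^*\times Q$. From configuration $(q,\tau)$, reading $(\sigma,d)$, a transition $(q,\sigma,\phi,\mathrm{asgn},o,q')$ with $\tau,d\models\phi$ leads to $(q',\tau')$ with $\tau'(r)=d$ if $r\in\mathrm{asgn}$ and $\tau'(r)=\tau(r)$ otherwise, outputting $(\gamma_1,\tau'(r_1))\cdots(\gamma_m,\tau'(r_m))$ where $o=(\gamma_1,r_1)\cdots(\gamma_m,r_m)$. An accepting run starts in $i_0$ with all registers equal to $d_0$ and visits $F$ infinitely often; standing assumption: accepting runs produce infinite outputs. $[\![T]\!]$ is the set of pairs (input, output) of accepting runs. An NRT with reassignments is defined in the same way except that the register operation of a transition is a set $I$ of instructions of the form $r:=\mathit{curr}$ or $r:=r'$ ($r,r'\in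 R$), each register occurring at most once as the left-hand side of an instruction in $I$. Its semantics: from $(q,\tau)$ reading data $d$, with the test satisfied by $d$ in $\tau$, first let $\tau''(s)=d$ if $(s:=\mathit{curr})\in I$ and $\tau''(s)=\tau(s)$ otherwise; then the new valuation is $\tau'(r)=\tau''(r')$ if $(r:=r')\in I$ and $\tau'(r)=\tau''(r)$ otherwise; outputs are computed from $\tau'$ as for NRT. -}

module Defs where

open import Data.Nat using (ℕ; zero; suc; _≤_)
open import Data.Fin using (Fin)
open import Data.Fin.Subset using (Subset) renaming (_∈_ to _∈ₛ_)
open import Data.Bool using (if_then_else_)
open import Data.Vec using (lookup)
open import Data.List using (List; []; _∷_; _++_; map; length; applyUpTo)
open import Data.List.Membership.Propositional using (_∈_)
open import Data.Maybe using (Maybe; just; nothing)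
open import Data.Product using (Σ; ∃; _×_; _,_; proj₁; proj₂)
open import Data.Sum using (_⊎_)
open import Relation.Binary.PropositionalEquality using (_≡_; _≢_)
open import Relation.Nullary using (¬_)

data Test (k : ℕ) : Set where
  ⊤ᵗ ⊥ᵗ : Test k
  eqᵗ neqᵗ : Fin k → Test k
  notᵗ : Test k → Test k
  andᵗ orᵗ : Test k → Test k → Test k

data Top : Set where
  tt : Top

data Bot : Set where

Sat : {D : Set} {k : ℕ} → (Fin k → D) → D → Test k → Set
Sat τ d ⊤ᵗ = Top
Sat τ d ⊥ᵗ = Bot
Sat τ d (eqᵗ r) = τ r ≡ d
Sat τ d (neqᵗ r) = τ r ≢ d
Sat τ d (notᵗ φ) = ¬ Sat τ d φ
Sat τ d (andᵗ φ ψ) = Sat τ d φ × Sat τ d ψ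
Sat τ d (orᵗ φ ψ) = Sat τ d φ ⊎ Sat τ d ψ

record Trans (Op : ℕ → Set) (s g n k : ℕ) : Set where
  field
    src  : Fin n
    lab  : Fin s
    test : Test k
    op   : Op k
    out  : List (Fin g × Fin k)
    tgt  : Fin n

record Machine (Op : ℕ → Set) (s g : ℕ) : Set where
  field
    nQ   : ℕ
    nR   : ℕ
    init : Fin nQ
    acc  : Subset nQ
    Δ    : List (Trans Op s g nQ nR)

NRT : ℕ → ℕ → Set
NRT = Machine Subset

applyAsgn : {D : Set} {k : ℕ} → Subset k → (Fin k → D) → D → (Fin k → D)
applyAsgn asgn τ d r = if lookup asgn r then d else τ r

-- Reassignment instructions: r := curr or r := r'.
data Src (k : ℕ) : Set where
  curr : Src k
  reg  : Fin k → Src k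

-- A set I of instructions in which every register occurs at most once as
-- left-hand side is exactly a partial map R ⇀ Src: I r = just e iff (r := e) ∈ I.
Instrs : ℕ → Set
Instrs k = Fin k → Maybe (Src k)

NRTr : ℕ → ℕ → Set
NRTr = Machine Instrs

applyInstrs : {D : Set} {k : ℕ} → Instrs k → (Fin k → D) → D → (Fin k → D)
applyInstrs {D} {k} I τ d r = second (I r)
  where
    τ'' : Fin k → D
    τ'' s with I s
    ... | just curr = d
    ... | _ = τ s
    second : Maybe (Src k) → D
    second (just (reg r')) = τ'' r'
    second _ = τ'' r

record Run {Op : ℕ → Set} {s g : ℕ} {D : Set}
           (apply : ∀ {k} → Op k → (Fin k → D) → D → (Fin k → D))
           (d₀ : D) (T : Machine Op s g) (x : ℕ → Fin s × D) : Set where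
  open Machine T
  field
    state  : ℕ → Fin nQ
    val    : ℕ → Fin nR → D
    trans  : ℕ → Trans Op s g nQ nR
    trans∈ : ∀ i → trans i ∈ Δ
    start  : state 0 ≡ init
    val₀   : ∀ r → val 0 r ≡ d₀
    srcOK  : ∀ i → Trans.src (trans i) ≡ state i
    labOK  : ∀ i → Trans.lab (trans i) ≡ proj₁ (x i)
    testOK : ∀ i → Sat (val i) (proj₂ (x i)) (Trans.test (trans i))
    tgtOK  : ∀ i → state (suc i) ≡ Trans.tgt (trans i)
    updOK  : ∀ i r → val (suc i) r ≡ apply (Trans.op (trans i)) (val i) (proj₂ (x i)) r

  outAt : ℕ → List (Fin g × D)
  outAt i = map (λ p → proj₁ p , val (suc i) (proj₂ p)) (Trans.out (trans i))

  outUpTo : ℕ → List (Fin g × D)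
  outUpTo zero = []
  outUpTo (suc n) = outUpTo n ++ outAt n

  Accepting : Set
  Accepting = ∀ m → ∃ λ j → m ≤ j × state j ∈ₛ acc

  InfiniteOutput : Set
  InfiniteOutput = ∀ m → ∃ λ n → m ≤ length (outUpTo n)

  OutputIs : (ℕ → Fin g × D) → Set
  OutputIs y = (∀ n → outUpTo n ≡ applyUpTo y (length (outUpTo n))) × InfiniteOutput

-- Standing assumption: accepting runs produce infinite outputs.
AccInfOut : {Op : ℕ → Set} {s g : ℕ} {D : Set}
            (apply : ∀ {k} → Op k → (Fin k → D) → D → (Fin k → D))
            (d₀ : D) (T : Machine Op s g) → Set
AccInfOut apply d₀ T = ∀ x (ρ : Run apply d₀ T x) → Run.Accepting ρ → Run.InfiniteOutput ρ

Sem : {Op : ℕ → Set} {s g : ℕ} {D : Set}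
      (apply : ∀ {k} → Op k → (Fin k → D) → D → (Fin k → D))
      (d₀ : D) (T : Machine Op s g) → (ℕ → Fin s × D) → (ℕ → Fin g × D) → Set
Sem apply d₀ T x y = Σ (Run apply d₀ T x) λ ρ → Run.Accepting ρ × Run.OutputIs ρ y

⟦_⟧NRT : {s g : ℕ} {D : Set} → NRT s g → D → (ℕ → Fin s × D) → (ℕ → Fin g × D) → Set
⟦ T ⟧NRT d₀ = Sem applyAsgn d₀ T

⟦_⟧NRTr : {s g : ℕ} {D : Set} → NRTr s g → D → (ℕ → Fin s × D) → (ℕ → Fin g × D) → Set
⟦ T ⟧NRTr d₀ = Sem applyInstrs d₀ T

module Submission where

-- Idea: an NRTr T with k registers is simulated by an NRT T' with k+1
-- physical registers whose control state additionally stores a placement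
-- π : Fin k → Fin (k+1), "logical register r of T currently lives in
-- physical register π r".  Since π is not surjective there is a register
-- fresh π outside its image; on each step T' stores the current datum
-- there (the only assignment it makes) and executes the instructions of
-- T *symbolically* on π, reading curr as fresh π.  Reassignments
-- r := r' thus become pointer moves in the finite control; tests and
-- outputs of T are renamed along π.

open import Defs
open import Data.Nat using (ℕ; zero; suc; _^_; _*_)
open import Data.Nat.Properties using (n<1+n)
open import Data.Fin using (Fin; zero; combine; remQuot; finToFun; funToFin)
open import Data.Fin.Properties
  using (remQuot-combine; combine-injective; finToFun-funToFin; any?; ¬∀⟶∃¬; pigeonhole; _≟_; <⇒≢)
open import Data.Fin.Subset using (Subset; ⁅_⁆) renaming (_∈_ to _∈ₛ_)
open import Data.Fin.Subset.Properties using (x∈⁅x⁆; x∈⁅y⁆⇒x≡y)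
open import Data.Bool using (true; false)
open import Data.Vec using (lookup; tabulate)
open import Data.Vec.Properties using ([]=⇒lookup; lookup⇒[]=; lookup∘tabulate)
open import Data.List using (List; _++_; map; concatMap; allFin; length; applyUpTo)
open import Data.List.Properties using (map-∘; map-cong)
open import Data.List.Membership.Propositional using (_∈_; find)
open import Data.List.Membership.Propositional.Properties
  using (∈-concatMap⁺; ∈-concatMap⁻; ∈-map⁺; ∈-map⁻; ∈-allFin)
import Data.List.Relation.Unary.Any as Any
open import Data.Maybe using (just; nothing)
open import Data.Product using (Σ; ∃; _×_; _,_; proj₁; proj₂)
open import Data.Sum using (inj₁; inj₂)
open import Data.Empty using (⊥-elim)
open import Function.Bundles using (_↔_)
open import Relation.Binary.PropositionalEquality
open import Relation.Nullary using (¬_)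

-- (1) A map Fin k → Fin (suc k) misses some point (pigeonhole): this is
-- the physical register that is free to receive the current datum.
module _ {k : ℕ} (π : Fin k → Fin (suc k)) where
  private
    InImage : Fin (suc k) → Set
    InImage p = ∃ λ r → π r ≡ p

    not-surjective : ¬ (∀ p → InImage p)
    not-surjective surj with pigeonhole (n<1+n k) (λ p → proj₁ (surj p))
    ... | i , j , i<j , same-preimage =
      <⇒≢ i<j (trans (sym (proj₂ (surj i))) (trans (cong π same-preimage) (proj₂ (surj j))))

    missed : ∃ λ p → ¬ InImage p
    missed = ¬∀⟶∃¬ (suc k) InImage (λ p → any? (λ r → π r ≟ p)) not-surjective

  fresh : Fin (suc k)
  fresh = proj₁ missed

  fresh-unused : ∀ r → π r ≢ fresh
  fresh-unused r e = proj₂ missed (r , e)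

assign-here : ∀ {D : Set} {n} (p : Fin n) (τ : Fin n → D) (d : D) →
  applyAsgn ⁅ p ⁆ τ d p ≡ d
assign-here p τ d rewrite []=⇒lookup (x∈⁅x⁆ p) = refl

assign-elsewhere : ∀ {D : Set} {n} {p q : Fin n} (τ : Fin n → D) (d : D) →
  q ≢ p → applyAsgn ⁅ p ⁆ τ d q ≡ τ q
assign-elsewhere {p = p} {q} τ d q≢p with lookup ⁅ p ⁆ q in q∈
... | true = ⊥-elim (q≢p (x∈⁅y⁆⇒x≡y p (lookup⇒[]= q ⁅ p ⁆ q∈)))
... | false = refl

rename : ∀ {k m} → (Fin k → Fin m) → Test k → Test m
rename π ⊤ᵗ = ⊤ᵗ
rename π ⊥ᵗ = ⊥ᵗ
rename π (eqᵗ r) = eqᵗ (π r)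
rename π (neqᵗ r) = neqᵗ (π r)
rename π (notᵗ φ) = notᵗ (rename π φ)
rename π (andᵗ φ ψ) = andᵗ (rename π φ) (rename π ψ)
rename π (orᵗ φ ψ) = orᵗ (rename π φ) (rename π ψ)

sat-rename : ∀ {D : Set} {k m} (τ' : Fin m → D) (π : Fin k → Fin m) (τ : Fin k → D) (d : D) →
  (∀ r → τ' (π r) ≡ τ r) → ∀ φ →
  (Sat τ' d (rename π φ) → Sat τ d φ) × (Sat τ d φ → Sat τ' d (rename π φ))
sat-rename τ' π τ d h ⊤ᵗ = (λ x → x) , (λ x → x)
sat-rename τ' π τ d h ⊥ᵗ = (λ x → x) , (λ x → x)
sat-rename τ' π τ d h (eqᵗ r) = trans (sym (h r)) , trans (h r)
sat-rename τ' π τ d h (neqᵗ r) = (λ ne e → ne (trans (h r) e)) , (λ ne e → ne (trans (sym (h r)) e))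
sat-rename τ' π τ d h (notᵗ φ) with sat-rename τ' π τ d h φ
... | to , from = (λ n x → n (from x)) , (λ n x → n (to x))
sat-rename τ' π τ d h (andᵗ φ ψ) with sat-rename τ' π τ d h φ | sat-rename τ' π τ d h ψ
... | to , from | to' , from' = (λ { (x , y) → to x , to' y }) , (λ { (x , y) → from x , from' y })
sat-rename τ' π τ d h (orᵗ φ ψ) with sat-rename τ' π τ d h φ | sat-rename τ' π τ d h ψ
... | to , from | to' , from' =
  (λ { (inj₁ x) → inj₁ (to x) ; (inj₂ y) → inj₂ (to' y) }) ,
  (λ { (inj₁ x) → inj₁ (from x) ; (inj₂ y) → inj₂ (from' y) })

-- (4) Instructions are natural in the register contents: executing I on
-- "addresses" π (with curr read as p) and then dereferencing through h
-- is executing I on the data h ∘ π, provided h p is the current datum.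
applyInstrs-natural : ∀ {A D : Set} {k} (I : Instrs k) (π : Fin k → A) (p : A)
  (h : A → D) (τ : Fin k → D) (d : D) → h p ≡ d → (∀ r → h (π r) ≡ τ r) →
  ∀ r → h (applyInstrs I π p r) ≡ applyInstrs I τ d r
applyInstrs-natural I π p h τ d hp hπ r with I r in eq
... | nothing rewrite eq = hπ r
... | just curr rewrite eq = hp
... | just (reg r') with I r' in eq'
...   | nothing = hπ r'
...   | just curr = hp
...   | just (reg _) = hπ r'

step : ∀ {k} → Instrs k → (Fin k → Fin (suc k)) → Fin k → Fin (suc k)
step I π = applyInstrs I π (fresh π)

step-simulates : ∀ {D : Set} {k} (I : Instrs k) (π : Fin k → Fin (suc k))
  (τ' : Fin (suc k) → D) (τ : Fin k → D) (d : D) → (∀ r → τ' (π r) ≡ τ r) →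
  ∀ r → applyAsgn ⁅ fresh π ⁆ τ' d (step I π r) ≡ applyInstrs I τ d r
step-simulates I π τ' τ d inv =
  applyInstrs-natural I π (fresh π) (applyAsgn ⁅ fresh π ⁆ τ' d) τ d
    (assign-here (fresh π) τ' d)
    (λ r → trans (assign-elsewhere τ' d (fresh-unused π r)) (inv r))

module SameOutputs {D : Set} {s g : ℕ} {d₀ : D} {Op Op' : ℕ → Set}
  {ap : ∀ {k} → Op k → (Fin k → D) → D → (Fin k → D)}
  {ap' : ∀ {k} → Op' k → (Fin k → D) → D → (Fin k → D)}
  {T : Machine Op s g} {T' : Machine Op' s g} {x : ℕ → Fin s × D}
  (ρ : Run ap d₀ T x) (ρ' : Run ap' d₀ T' x)
  (same : ∀ i → Run.outAt ρ i ≡ Run.outAt ρ' i) where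

  outUpTo-same : ∀ n → Run.outUpTo ρ n ≡ Run.outUpTo ρ' n
  outUpTo-same zero = refl
  outUpTo-same (suc n) = cong₂ _++_ (outUpTo-same n) (same n)

  infinite : Run.InfiniteOutput ρ' → Run.InfiniteOutput ρ
  infinite inf m with inf m
  ... | n , m≤ rewrite sym (outUpTo-same n) = n , m≤

  output : ∀ y → Run.OutputIs ρ' y → Run.OutputIs ρ y
  output y (prefixes , inf) =
    (λ n → subst (λ l → l ≡ applyUpTo y (length l)) (sym (outUpTo-same n)) (prefixes n)) ,
    infinite inf

module Construction {D : Set} (d₀ : D) {s g : ℕ} (T : NRTr s g) where
  module T = Machine T

  k : ℕ
  k = T.nR

  M : ℕ
  M = suc k ^ k

  placement : Fin M → Fin k → Fin (suc k)
  placement = finToFun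

  code : (Fin k → Fin (suc k)) → Fin M
  code = funToFin

  ⟨_,_⟩ : Fin T.nQ → Fin M → Fin (T.nQ * M)
  ⟨ q , c ⟩ = combine q c

  Trans' : Set
  Trans' = Trans Subset s g (T.nQ * M) (suc k)

  simulate : Trans Instrs s g T.nQ k → Fin M → Trans'
  simulate t c = record
    { src = ⟨ Trans.src t , c ⟩
    ; lab = Trans.lab t
    ; test = rename π (Trans.test t)
    ; op = ⁅ fresh π ⁆
    ; out = map (λ o → proj₁ o , step (Trans.op t) π (proj₂ o)) (Trans.out t)
    ; tgt = ⟨ Trans.tgt t , code (step (Trans.op t) π) ⟩
    }
    where π = placement c

  Δ' : List Trans'
  Δ' = concatMap (λ t → map (simulate t) (allFin M)) T.Δ

  simulate∈Δ' : ∀ {t} c → t ∈ T.Δ → simulate t c ∈ Δ'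
  simulate∈Δ' {t} c t∈ =
    ∈-concatMap⁺ (λ t → map (simulate t) (allFin M))
      (Any.map {P = t ≡_} (λ { refl → ∈-map⁺ (simulate t) (∈-allFin c) }) t∈)

  Δ'-simulates : ∀ {t'} → t' ∈ Δ' →
    Σ (Trans Instrs s g T.nQ k) λ t → Σ (Fin M) λ c → t ∈ T.Δ × t' ≡ simulate t c
  Δ'-simulates t'∈ with find (∈-concatMap⁻ (λ t → map (simulate t) (allFin M)) {xs = T.Δ} t'∈)
  ... | t , t∈ , t'∈copies with ∈-map⁻ (simulate t) t'∈copies
  ... | c , _ , t'≡ = t , c , t∈ , t'≡

  -- Initially every logical register sits in physical register 0, holding d₀.
  c₀ : Fin M
  c₀ = code (λ _ → zero)

  T' : NRT s g
  T' = record
    { nQ = T.nQ * M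
    ; nR = suc k
    ; init = ⟨ T.init , c₀ ⟩
    ; acc = tabulate (λ qc → lookup T.acc (proj₁ (remQuot {T.nQ} M qc)))
    ; Δ = Δ' }

  acc-lookup : ∀ q c → lookup (Machine.acc T') ⟨ q , c ⟩ ≡ lookup T.acc q
  acc-lookup q c = trans (lookup∘tabulate _ ⟨ q , c ⟩)
                         (cong (λ qc → lookup T.acc (proj₁ qc)) (remQuot-combine q c))

  acc'⇒acc : ∀ q c → ⟨ q , c ⟩ ∈ₛ Machine.acc T' → q ∈ₛ T.acc
  acc'⇒acc q c h = lookup⇒[]= q T.acc (trans (sym (acc-lookup q c)) ([]=⇒lookup h))

  acc⇒acc' : ∀ q c → q ∈ₛ T.acc → ⟨ q , c ⟩ ∈ₛ Machine.acc T'
  acc⇒acc' q c h = lookup⇒[]= ⟨ q , c ⟩ _ (trans (acc-lookup q c) ([]=⇒lookup h))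

  module Forward (x : ℕ → Fin s × D) (ρ : Run applyInstrs d₀ T x) where
    open Run ρ renaming (trans to tr)

    c : ℕ → Fin M
    c zero = c₀
    c (suc i) = code (step (Trans.op (tr i)) (placement (c i)))

    val' : ℕ → Fin (suc k) → D
    val' zero _ = d₀
    val' (suc i) = applyAsgn ⁅ fresh (placement (c i)) ⁆ (val' i) (proj₂ (x i))

    invariant : ∀ i r → val' i (placement (c i) r) ≡ val i r
    invariant-step : ∀ i r → val' (suc i) (step (Trans.op (tr i)) (placement (c i)) r) ≡ val (suc i) r
    invariant-step i r =
      trans (step-simulates (Trans.op (tr i)) (placement (c i)) (val' i) (val i) (proj₂ (x i)) (invariant i) r)
            (sym (updOK i r))
    invariant zero r = sym (val₀ r)
    invariant (suc i) r = trans (cong (val' (suc i)) (finToFun-funToFin _ r)) (invariant-step i r)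

    ρ' : Run applyAsgn d₀ T' x
    ρ' = record
      { state = λ i → ⟨ state i , c i ⟩
      ; val = val'
      ; trans = λ i → simulate (tr i) (c i)
      ; trans∈ = λ i → simulate∈Δ' (c i) (trans∈ i)
      ; start = cong ⟨_, c₀ ⟩ start
      ; val₀ = λ _ → refl
      ; srcOK = λ i → cong ⟨_, c i ⟩ (srcOK i)
      ; labOK = labOK
      ; testOK = λ i → proj₂ (sat-rename (val' i) (placement (c i)) (val i) (proj₂ (x i)) (invariant i)
                                          (Trans.test (tr i))) (testOK i)
      ; tgtOK = λ i → cong ⟨_, c (suc i) ⟩ (tgtOK i)
      ; updOK = λ _ _ → refl
      }

    same-outputs : ∀ i → Run.outAt ρ' i ≡ outAt i
    same-outputs i = trans (sym (map-∘ (Trans.out (tr i))))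
                           (map-cong (λ o → cong (proj₁ o ,_) (invariant-step i (proj₂ o))) (Trans.out (tr i)))

    accepting : Accepting → Run.Accepting ρ'
    accepting acc m with acc m
    ... | j , m≤j , inF = j , m≤j , acc⇒acc' (state j) (c j) inF

  -- Every run of T' projects to a run of T with the same step outputs:
  -- each transition of T' is a copy simulate t c, and the logical
  -- valuation is read off through the placement c.
  module Backward (x : ℕ → Fin s × D) (ρ' : Run applyAsgn d₀ T' x) where
    module R = Run ρ'

    origin : ∀ i → Σ (Trans Instrs s g T.nQ k) λ t → Σ (Fin M) λ c → t ∈ T.Δ × R.trans i ≡ simulate t c
    origin i = Δ'-simulates (R.trans∈ i)

    t : ℕ → Trans Instrs s g T.nQ k
    t i = proj₁ (origin i)

    c : ℕ → Fin M
    c i = proj₁ (proj₂ (origin i))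

    t∈ : ∀ i → t i ∈ T.Δ
    t∈ i = proj₁ (proj₂ (proj₂ (origin i)))

    is-copy : ∀ i → R.trans i ≡ simulate (t i) (c i)
    is-copy i = proj₂ (proj₂ (proj₂ (origin i)))

    π : ℕ → Fin k → Fin (suc k)
    π i = placement (c i)

    val : ℕ → Fin k → D
    val i r = R.val i (π i r)

    src-state : ∀ i → ⟨ Trans.src (t i) , c i ⟩ ≡ R.state i
    src-state i = trans (cong Trans.src (sym (is-copy i))) (R.srcOK i)

    chained : ∀ i → Trans.src (t (suc i)) ≡ Trans.tgt (t i) × c (suc i) ≡ code (step (Trans.op (t i)) (π i))
    chained i = combine-injective _ _ _ _
      (trans (src-state (suc i)) (trans (R.tgtOK i) (cong Trans.tgt (is-copy i))))

    val-suc : ∀ i r → val (suc i) r ≡ R.val (suc i) (step (Trans.op (t i)) (π i) r)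
    val-suc i r = cong (R.val (suc i))
      (trans (cong (λ c' → placement c' r) (proj₂ (chained i))) (finToFun-funToFin _ r))

    update : ∀ i r → val (suc i) r ≡ applyInstrs (Trans.op (t i)) (val i) (proj₂ (x i)) r
    update i r = begin
      val (suc i) r                                              ≡⟨ val-suc i r ⟩
      R.val (suc i) q                                            ≡⟨ R.updOK i q ⟩
      applyAsgn (Trans.op (R.trans i)) (R.val i) (proj₂ (x i)) q ≡⟨ cong (λ t' → applyAsgn (Trans.op t') (R.val i) (proj₂ (x i)) q) (is-copy i) ⟩
      applyAsgn ⁅ fresh (π i) ⁆ (R.val i) (proj₂ (x i)) q       ≡⟨ step-simulates (Trans.op (t i)) (π i) (R.val i) (val i) (proj₂ (x i)) (λ _ → refl) r ⟩
      applyInstrs (Trans.op (t i)) (val i) (proj₂ (x i)) r       ∎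
      where
        open ≡-Reasoning
        q = step (Trans.op (t i)) (π i) r

    ρ : Run applyInstrs d₀ T x
    ρ = record
      { state = λ i → Trans.src (t i)
      ; val = val
      ; trans = t
      ; trans∈ = t∈
      ; start = proj₁ (combine-injective _ _ _ _ (trans (src-state 0) R.start))
      ; val₀ = λ _ → R.val₀ _
      ; srcOK = λ _ → refl
      ; labOK = λ i → trans (cong Trans.lab (sym (is-copy i))) (R.labOK i)
      ; testOK = λ i → proj₁ (sat-rename (R.val i) (π i) (val i) (proj₂ (x i)) (λ _ → refl) (Trans.test (t i)))
                             (subst (λ t' → Sat (R.val i) (proj₂ (x i)) (Trans.test t')) (is-copy i) (R.testOK i))
      ; tgtOK = λ i → proj₁ (chained i)
      ; updOK = update
      }

    same-outputs : ∀ i → Run.outAt ρ i ≡ R.outAt i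
    same-outputs i = begin
      Run.outAt ρ i
        ≡⟨ map-cong (λ o → cong (proj₁ o ,_) (val-suc i (proj₂ o))) (Trans.out (t i)) ⟩
      map (λ o → proj₁ o , R.val (suc i) (step (Trans.op (t i)) (π i) (proj₂ o))) (Trans.out (t i))
        ≡⟨ map-∘ (Trans.out (t i)) ⟩
      map (λ o → proj₁ o , R.val (suc i) (proj₂ o)) (Trans.out (simulate (t i) (c i)))
        ≡⟨ cong (λ t' → map (λ o → proj₁ o , R.val (suc i) (proj₂ o)) (Trans.out t')) (sym (is-copy i)) ⟩
      R.outAt i ∎
      where open ≡-Reasoning

    accepting : R.Accepting → Run.Accepting ρ
    accepting acc m with acc m
    ... | j , m≤j , inF = j , m≤j , acc'⇒acc (Trans.src (t j)) (c j) (subst (_∈ₛ Machine.acc T') (sym (src-state j)) inF)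

theorem4 : (D : Set) → D ↔ ℕ → (d₀ : D) → (s g : ℕ) →
    (T : NRTr s g) → AccInfOut applyInstrs d₀ T →
    Σ (NRT s g) λ T' → AccInfOut applyAsgn d₀ T' ×
    (∀ (x : ℕ → Fin s × D) (y : ℕ → Fin g × D) →
    (⟦ T ⟧NRTr d₀ x y → ⟦ T' ⟧NRT d₀ x y) × (⟦ T' ⟧NRT d₀ x y → ⟦ T ⟧NRTr d₀ x y))
theorem4 D _ d₀ s g T infinite = T' , infinite' , λ x y → forward x y , backward x y
  where
    open Construction d₀ T

    -- an accepting run of T' projects to an accepting run of T, whose output is infinite
    infinite' : AccInfOut applyAsgn d₀ T'
    infinite' x ρ' acc = SameOutputs.infinite ρ' ρ (λ i → sym (same-outputs i)) (infinite x ρ (accepting acc))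
      where open Backward x ρ'

    forward : ∀ x y → ⟦ T ⟧NRTr d₀ x y → ⟦ T' ⟧NRT d₀ x y
    forward x y (ρ , acc , out) = ρ' , accepting acc , SameOutputs.output ρ' ρ same-outputs y out
      where open Forward x ρ

    backward : ∀ x y → ⟦ T' ⟧NRT d₀ x y → ⟦ T ⟧NRTr d₀ x y
    backward x y (ρ' , acc , out) = ρ , accepting acc , SameOutputs.output ρ ρ' same-outputs y out
      where open Backward x ρ'
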